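{- Let $F$ be a DeMorgan circuit computing a Boolean function $f:\{0,1\}^n\to\{0,1\}$. If $F$ produces a zero-term $t$ such that $t^+\not\le f^{\uparrow}$, then $F$ has a $0$-hazard.
   Context: A DeMorgan circuit on $x_1,\dots,x_n$ has fan-in-2 AND/OR gates and inputs $0,1,x_i,\bar x_i$. A zero-term is a term (AND of literals) containing some $x_i$ together with $\bar x_i$. Produced terms: at an input gate, the literal/constant itself; at an OR gate, the union of the sets at its two inputs; at an AND gate, all $t_1\land t_2$ with $t_1,t_2$ produced at the two inputs (no simplification $x\bar x=0$). $t^+$ is $t$ with each negated literal replaced by $1$; $f^{\uparrow}(x)=\bigvee_{z\le x}f(z)$. Ternary logic on $\{0,\mathfrak u,1\}$ ($\mathfrak u=1/2$): AND $=\min$, OR $=\max$, NOT $=1-x$. $S_\alpha$ is the set of Boolean vectors obtained from $\alpha\in\{0,\mathfrak u,1\}^n$ by replacing each $\mathfrak u$ by $0$ or $1$. $F$ has a $0$-hazard at $\alpha$ if $F(a)=0$ for all $a\in S_\alpha$ but $F(\alpha)=\mathfrak u$. -}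

module Defs where

open import Data.Nat using (ℕ)
open import Data.Fin using (Fin)
open import Data.Bool using (Bool; true; false; _∧_; _∨_; not)
import Data.Bool as B
open import Data.List using (List; []; _∷_; _++_; concatMap; map)
open import Data.List.Membership.Propositional using (_∈_)
open import Data.Unit using (⊤)
open import Data.Empty using (⊥)
open import Data.Product using (Σ; ∃; _×_)
open import Relation.Binary.PropositionalEquality using (_≡_)

data Lit (n : ℕ) : Set where
  c0 c1 : Lit n
  pos neg : Fin n → Lit n

data Circuit (n : ℕ) : Set where
  input : Lit n → Circuit n
  and or : Circuit n → Circuit n → Circuit n

evalLit : ∀ {n} → Lit n → (Fin n → Bool) → Bool
evalLit c0 x = false
evalLit c1 x = true
evalLit (pos i) x = x i
evalLit (neg i) x = not (x i)

eval : ∀ {n} → Circuit n → (Fin n → Bool) → Bool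
eval (input l) x = evalLit l x
eval (and F G) x = eval F x ∧ eval G x
eval (or F G) x = eval F x ∨ eval G x

Computes : ∀ {n} → Circuit n → ((Fin n → Bool) → Bool) → Set
Computes F f = ∀ x → eval F x ≡ f x

-- Ternary logic on {0, u, 1}: AND = min, OR = max, NOT = 1 - x
data T : Set where
  t0 tu t1 : T

minT : T → T → T
minT t0 _ = t0
minT tu t0 = t0
minT tu _ = tu
minT t1 b = b

maxT : T → T → T
maxT t1 _ = t1
maxT tu t1 = t1
maxT tu _ = tu
maxT t0 b = b

notT : T → T
notT t0 = t1
notT tu = tu
notT t1 = t0

evalLitT : ∀ {n} → Lit n → (Fin n → T) → T
evalLitT c0 α = t0
evalLitT c1 α = t1
evalLitT (pos i) α = α i
evalLitT (neg i) α = notT (α i)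

evalT : ∀ {n} → Circuit n → (Fin n → T) → T
evalT (input l) α = evalLitT l α
evalT (and F G) α = minT (evalT F α) (evalT G α)
evalT (or F G) α = maxT (evalT F α) (evalT G α)

Resolves : Bool → T → Set
Resolves false t0 = ⊤
Resolves true  t0 = ⊥
Resolves _     tu = ⊤
Resolves false t1 = ⊥
Resolves true  t1 = ⊤

InS : ∀ {n} → (Fin n → Bool) → (Fin n → T) → Set
InS a α = ∀ i → Resolves (a i) (α i)

ZeroHazardAt : ∀ {n} → Circuit n → (Fin n → T) → Set
ZeroHazardAt F α = (∀ a → InS a α → eval F a ≡ false) × (evalT F α ≡ tu)

HasZeroHazard : ∀ {n} → Circuit n → Set
HasZeroHazard {n} F = ∃ λ (α : Fin n → T) → ZeroHazardAt F α

-- Terms: conjunctions of literals/constants, kept as lists (no simplification)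
Term : ℕ → Set
Term n = List (Lit n)

produced : ∀ {n} → Circuit n → List (Term n)
produced (input l) = (l ∷ []) ∷ []
produced (or F G) = produced F ++ produced G
produced (and F G) = concatMap (λ t₁ → map (λ t₂ → t₁ ++ t₂) (produced G)) (produced F)

Produces : ∀ {n} → Circuit n → Term n → Set
Produces F t = t ∈ produced F

IsZeroTerm : ∀ {n} → Term n → Set
IsZeroTerm {n} t = ∃ λ (i : Fin n) → (pos i ∈ t) × (neg i ∈ t)

plusLit : ∀ {n} → Lit n → Lit n
plusLit (neg i) = c1
plusLit l = l

_⁺ : ∀ {n} → Term n → Term n
t ⁺ = map plusLit t

termFun : ∀ {n} → Term n → (Fin n → Bool) → Bool
termFun [] x = true
termFun (l ∷ t) x = evalLit l x ∧ termFun t x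

_≤v_ : ∀ {n} → (Fin n → Bool) → (Fin n → Bool) → Set
z ≤v x = ∀ i → z i B.≤ x i

-- f↑(x) = OR_{z ≤ x} f(z)  (as a predicate: f↑ x = 1)
Up : ∀ {n} → ((Fin n → Bool) → Bool) → (Fin n → Bool) → Set
Up f x = ∃ λ z → (z ≤v x) × (f z ≡ true)

_≤Up_ : ∀ {n} → ((Fin n → Bool) → Bool) → ((Fin n → Bool) → Bool) → Set
g ≤Up f = ∀ x → g x ≡ true → Up f x

-- Choose x with t⁺(x) = 1 but f↑(x) = 0, and let α be x with every 1 replaced by 𝔲, so that S_α
-- is the down-set of x and F vanishes on it. Every literal of t is nonzero at α (x_i = 1 gives 𝔲,
-- a negated literal gives 1 or 𝔲), and a ternary 0 at a gate propagates into every term produced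
-- there, so F(α) ≠ 0. By Kleene's monotonicity F(α) resolves F(0) = 0, so F(α) ≠ 1; hence
-- F(α) = 𝔲. Finding x needs the decidability of f↑ on the finite cube.
module Submission where

open import Defs
open import Data.Nat using (ℕ)
open import Data.Fin using (Fin)
open import Data.Fin.Properties using (all?)
open import Data.Fin.Subset.Properties using (anySubset?)
open import Data.Bool using (Bool; true; false; _∧_; _∨_; not; if_then_else_)
import Data.Bool as B
open import Data.Bool.Properties using (_≟_; _≤?_; ¬-not; ∧-zeroʳ)
open import Data.Vec using (lookup; tabulate)
open import Data.Vec.Properties using (lookup∘tabulate)
open import Data.List using ([]; _∷_; _++_; map)
open import Data.List.Membership.Propositional.Properties using (∈-++⁻; ∈-map⁻; ∈-concat⁻′)
open import Data.List.Relation.Unary.Any using (Any; here; there)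
import Data.List.Relation.Unary.Any as Any
open import Data.List.Relation.Unary.Any.Properties using (++⁺ˡ; ++⁺ʳ; map⁺)
open import Data.Unit using (tt)
open import Data.Empty using (⊥-elim)
open import Data.Sum using (_⊎_; inj₁; inj₂)
open import Data.Product using (∃; ∃₂; _×_; _,_)
open import Function using (_∘_)
open import Relation.Binary.PropositionalEquality using (_≡_; _≢_; _≗_; refl; sym; trans; cong; cong₂; subst)
open import Relation.Nullary using (¬_; Dec; yes; no)
open import Relation.Nullary.Decidable using (map′; _×-dec_; ¬?)

private
  variable
    n : ℕ

∧-resolves : ∀ b₁ b₂ s₁ s₂ → Resolves b₁ s₁ → Resolves b₂ s₂ → Resolves (b₁ ∧ b₂) (minT s₁ s₂)
∧-resolves false _     t0 _  _ _  = tt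
∧-resolves false _     tu t0 _ _  = tt
∧-resolves false _     tu tu _ _  = tt
∧-resolves false _     tu t1 _ _  = tt
∧-resolves true  _     tu t0 _ r₂ = r₂
∧-resolves true  _     tu tu _ r₂ = r₂
∧-resolves true  false tu t1 _ _  = tt
∧-resolves true  true  tu t1 _ _  = tt
∧-resolves true  _     t1 _  _ r₂ = r₂

∨-resolves : ∀ b₁ b₂ s₁ s₂ → Resolves b₁ s₁ → Resolves b₂ s₂ → Resolves (b₁ ∨ b₂) (maxT s₁ s₂)
∨-resolves true  _     t1 _  _ _  = tt
∨-resolves true  _     tu t0 _ _  = tt
∨-resolves true  _     tu tu _ _  = tt
∨-resolves true  _     tu t1 _ _  = tt
∨-resolves false _     tu t1 _ r₂ = r₂
∨-resolves false _     tu tu _ r₂ = r₂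
∨-resolves false false tu t0 _ _  = tt
∨-resolves false true  tu t0 _ _  = tt
∨-resolves false _     t0 _  _ r₂ = r₂

not-resolves : ∀ b s → Resolves b s → Resolves (not b) (notT s)
not-resolves false t0 _ = tt
not-resolves false tu _ = tt
not-resolves true  tu _ = tt
not-resolves true  t1 _ = tt

eval-resolves : (F : Circuit n) (a : Fin n → Bool) (α : Fin n → T) →
                InS a α → Resolves (eval F a) (evalT F α)
eval-resolves (input c0)      a α a∈α = tt
eval-resolves (input c1)      a α a∈α = tt
eval-resolves (input (pos i)) a α a∈α = a∈α i
eval-resolves (input (neg i)) a α a∈α = not-resolves (a i) (α i) (a∈α i)
eval-resolves (and F G)       a α a∈α =
  ∧-resolves _ _ _ _ (eval-resolves F a α a∈α) (eval-resolves G a α a∈α)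
eval-resolves (or F G)        a α a∈α =
  ∨-resolves _ _ _ _ (eval-resolves F a α a∈α) (eval-resolves G a α a∈α)

minT≡t0⁻ : ∀ s₁ s₂ → minT s₁ s₂ ≡ t0 → s₁ ≡ t0 ⊎ s₂ ≡ t0
minT≡t0⁻ t0 _  _ = inj₁ refl
minT≡t0⁻ tu t0 _ = inj₂ refl
minT≡t0⁻ t1 _  e = inj₂ e

maxT≡t0⁻ : ∀ s₁ s₂ → maxT s₁ s₂ ≡ t0 → s₁ ≡ t0 × s₂ ≡ t0
maxT≡t0⁻ t0 _  e = refl , e
maxT≡t0⁻ tu t0 ()
maxT≡t0⁻ tu tu ()
maxT≡t0⁻ tu t1 ()

∈-produced-and⁻ : ∀ (F G : Circuit n) {t} → Produces (and F G) t →
                  ∃₂ λ t₁ t₂ → Produces F t₁ × Produces G t₂ × t ≡ t₁ ++ t₂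
∈-produced-and⁻ F G t∈ with ∈-concat⁻′ _ t∈
... | ts , t∈ts , ts∈ with ∈-map⁻ (λ t₁ → map (t₁ ++_) (produced G)) ts∈
...   | t₁ , t₁∈ , refl with ∈-map⁻ (t₁ ++_) t∈ts
...     | t₂ , t₂∈ , refl = t₁ , t₂ , t₁∈ , t₂∈ , refl

produced-has-t0-literal : (F : Circuit n) (α : Fin n → T) → evalT F α ≡ t0 →
                          ∀ {t} → Produces F t → Any (λ l → evalLitT l α ≡ t0) t
produced-has-t0-literal (input l) α F≡0 (here refl) = here F≡0
produced-has-t0-literal (or F G) α F≡0 t∈
  with maxT≡t0⁻ (evalT F α) (evalT G α) F≡0 | ∈-++⁻ (produced F) t∈
... | F≡0 , _ | inj₁ t∈F = produced-has-t0-literal F α F≡0 t∈F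
... | _ , G≡0 | inj₂ t∈G = produced-has-t0-literal G α G≡0 t∈G
produced-has-t0-literal (and F G) α F≡0 t∈
  with ∈-produced-and⁻ F G t∈ | minT≡t0⁻ (evalT F α) (evalT G α) F≡0
... | t₁ , t₂ , t₁∈ , t₂∈ , refl | inj₁ F≡0 = ++⁺ˡ (produced-has-t0-literal F α F≡0 t₁∈)
... | t₁ , t₂ , t₁∈ , t₂∈ , refl | inj₂ G≡0 = ++⁺ʳ t₁ (produced-has-t0-literal G α G≡0 t₂∈)

evalLit-cong : ∀ (l : Lit n) {x y} → x ≗ y → evalLit l x ≡ evalLit l y
evalLit-cong c0      x≗y = refl
evalLit-cong c1      x≗y = refl
evalLit-cong (pos i) x≗y = x≗y i
evalLit-cong (neg i) x≗y = cong not (x≗y i)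

eval-cong : ∀ (F : Circuit n) {x y} → x ≗ y → eval F x ≡ eval F y
eval-cong (input l) x≗y = evalLit-cong l x≗y
eval-cong (and F G) x≗y = cong₂ _∧_ (eval-cong F x≗y) (eval-cong G x≗y)
eval-cong (or F G)  x≗y = cong₂ _∨_ (eval-cong F x≗y) (eval-cong G x≗y)

termFun-cong : ∀ (t : Term n) {x y} → x ≗ y → termFun t x ≡ termFun t y
termFun-cong []      x≗y = refl
termFun-cong (l ∷ t) x≗y = cong₂ _∧_ (evalLit-cong l x≗y) (termFun-cong t x≗y)

Extensional : ((Fin n → Bool) → Set) → Set
Extensional P = ∀ {x y} → x ≗ y → P x → P y

∃-cube? : {P : (Fin n → Bool) → Set} → Extensional P → (∀ x → Dec (P x)) → Dec (∃ P)
∃-cube? ext P? = map′ (λ (v , p) → lookup v , p)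
                      (λ (x , p) → tabulate x , ext (sym ∘ lookup∘tabulate x) p)
                      (anySubset? (P? ∘ lookup))

Up-ext : (g : (Fin n → Bool) → Bool) → Extensional (Up g)
Up-ext g x≗y (z , z≤x , gz) = z , (λ i → subst (z i B.≤_) (x≗y i) (z≤x i)) , gz

Up-eval? : (F : Circuit n) → ∀ x → Dec (Up (eval F) x)
Up-eval? F x = ∃-cube? ext (λ z → all? (λ i → z i ≤? x i) ×-dec (eval F z ≟ true))
  where
  ext : Extensional (λ z → (z ≤v x) × (eval F z ≡ true))
  ext z≗z′ (z≤x , Fz) = (λ i → subst (B._≤ x i) (z≗z′ i) (z≤x i)) , trans (sym (eval-cong F z≗z′)) Fz

counterexample : {P Q : (Fin n → Bool) → Set} → Extensional P → Extensional Q →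
                 (∀ x → Dec (P x)) → (∀ x → Dec (Q x)) →
                 ¬ (∀ x → P x → Q x) → ∃ λ x → P x × ¬ Q x
counterexample {P = P} {Q} extP extQ P? Q? ¬P⇒Q
  with ∃-cube? (λ x≗y (p , ¬q) → extP x≗y p , ¬q ∘ extQ (sym ∘ x≗y)) (λ x → P? x ×-dec ¬? (Q? x))
... | yes witness = witness
... | no none = ⊥-elim (¬P⇒Q Q-from-P)
  where
  Q-from-P : ∀ x → P x → Q x
  Q-from-P x p with Q? x
  ... | yes q = q
  ... | no ¬q = ⊥-elim (none (x , p , ¬q))

blurOnes : (Fin n → Bool) → Fin n → T
blurOnes x i = if x i then tu else t0

∈S-blurOnes⇒≤v : ∀ (x a : Fin n → Bool) → InS a (blurOnes x) → a ≤v x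
∈S-blurOnes⇒≤v x a a∈ i with x i | a i | a∈ i
... | true  | false | _ = B.f≤t
... | true  | true  | _ = B.b≤b
... | false | false | _ = B.b≤b

zeros-∈S-blurOnes : (x : Fin n → Bool) → InS (λ _ → false) (blurOnes x)
zeros-∈S-blurOnes x i with x i
... | true  = tt
... | false = tt

t0-at-blurOnes⇒plus-false : ∀ (x : Fin n → Bool) l → evalLitT l (blurOnes x) ≡ t0 →
                            evalLit (plusLit l) x ≡ false
t0-at-blurOnes⇒plus-false x c0      _ = refl
t0-at-blurOnes⇒plus-false x (pos i) e with x i
... | false = refl
t0-at-blurOnes⇒plus-false x (neg i) e with x i
t0-at-blurOnes⇒plus-false x (neg i) () | true
t0-at-blurOnes⇒plus-false x (neg i) () | false

termFun-false : ∀ (t : Term n) x → Any (λ l → evalLit l x ≡ false) t → termFun t x ≡ false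
termFun-false (l ∷ t) x (here l≡0) rewrite l≡0 = refl
termFun-false (l ∷ t) x (there t≡0) rewrite termFun-false t x t≡0 = ∧-zeroʳ (evalLit l x)

blurOnes-nonzero : (F : Circuit n) (t : Term n) (x : Fin n → Bool) → Produces F t →
                   termFun (t ⁺) x ≡ true → evalT F (blurOnes x) ≢ t0
blurOnes-nonzero F t x t∈ t⁺x F≡0
  with trans (sym t⁺x) (termFun-false (t ⁺) x (map⁺ (Any.map (λ {l} → t0-at-blurOnes⇒plus-false x l)
                                                            (produced-has-t0-literal F _ F≡0 t∈))))
... | ()

zero-hazard-at-blurOnes : (F : Circuit n) (t : Term n) (x : Fin n → Bool) → Produces F t →
                          termFun (t ⁺) x ≡ true → ¬ Up (eval F) x → ZeroHazardAt F (blurOnes x)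
zero-hazard-at-blurOnes F t x t∈ t⁺x ¬up = vanishes , F-undetermined
  where
  vanishes : ∀ a → InS a (blurOnes x) → eval F a ≡ false
  vanishes a a∈ = ¬-not (λ Fa → ¬up (a , ∈S-blurOnes⇒≤v x a a∈ , Fa))

  F-undetermined : evalT F (blurOnes x) ≡ tu
  F-undetermined with evalT F (blurOnes x) in F≡ | eval-resolves F _ _ (zeros-∈S-blurOnes x)
  ... | t0 | _  = ⊥-elim (blurOnes-nonzero F t x t∈ t⁺x F≡)
  ... | tu | _  = refl
  ... | t1 | F0 = ⊥-elim (subst (λ b → Resolves b t1) (vanishes _ (zeros-∈S-blurOnes x)) F0)

corollary1 : ∀ {n} (F : Circuit n) (f : (Fin n → Bool) → Bool) → Computes F f →
    (t : Term n) → Produces F t → IsZeroTerm t → ¬ (termFun (t ⁺) ≤Up f) →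
    HasZeroHazard F
corollary1 F f F≗f t t∈ _ t⁺≰f↑ =
  let x , t⁺x , ¬up = counterexample (λ x≗y → trans (sym (termFun-cong (t ⁺) x≗y))) (Up-ext (eval F))
                        (λ x → termFun (t ⁺) x ≟ true) (Up-eval? F) t⁺≰F↑
  in blurOnes x , zero-hazard-at-blurOnes F t x t∈ t⁺x ¬up
  where
  t⁺≰F↑ : ¬ (∀ x → termFun (t ⁺) x ≡ true → Up (eval F) x)
  t⁺≰F↑ t⁺≤ = t⁺≰f↑ λ x t⁺x → let z , z≤x , Fz = t⁺≤ x t⁺x in z , z≤x , trans (sym (F≗f z)) Fz
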